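{- Let $n\ge 4$, $N=\{1,\dots,n\}$, let $i_1\in N$, and let $\hat N^c=N\setminus\{i_1\}$. Then the inequality $$\sum_{j\in\hat N^c}\left(x_{i_1j}+x_{ji_1}\right)-\sum_{j,j'\in\hat N^c:\ j\ne j'} x_{jj'}\ \le\ 2-\frac{(n-2)(n-3)}{2}$$ is a valid inequality for the weak order polytope $P^n_{WO}$.
   Context: Let $N=\{1,\dots,n\}$ and $A_N=\{(i,j): i,j\in N,\ i\ne j\}$. A weak order on $N$ is a binary relation $W\subseteq N\times N$ that is reflexive, transitive and total (for all $i,j$, $(i,j)\in W$ or $(j,i)\in W$); $(i,j)\in W$ is read "$i$ is preferred over or tied with $j$". The characteristic vector of $W$ is $x^W\in\{0,1\}^{A_N}$ with $x^W_{ij}=1$ if $(i,j)\in W$ and $0$ otherwise. The weak order polytope $P^n_{WO}\subseteq\mathbb{R}^{A_N}$ is the convex hull of the characteristic vectors of all weak orders on $N$. An inequality $\pi x\le \pi_0$ is valid for a polytope $P$ if it holds for every $x\in P$ (equivalently, here, for every characteristic vector of a weak order). -}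

module Defs where

open import Data.Nat using (ℕ; zero; suc; _∸_; _/_) renaming (_*_ to _*ℕ_)
open import Data.Fin using (Fin; zero; suc; _≟_)
open import Data.Bool using (Bool; true; false)
open import Data.Integer using (ℤ; +_; _+_; _-_; _≤_)
open import Relation.Nullary using (¬_; yes; no)
open import Relation.Binary.PropositionalEquality using (_≡_)
open import Data.Sum using (_⊎_)

-- Ground set N = {1,…,n} is represented by Fin n.
-- A binary relation on N, given by its (decidable) membership predicate:
-- (i , j) ∈ W  iff  W i j ≡ true.
Rel₂ : ℕ → Set
Rel₂ n = Fin n → Fin n → Bool

record IsWeakOrder {n : ℕ} (W : Rel₂ n) : Set where
  field
    reflexive  : ∀ i → W i i ≡ true
    transitive : ∀ i j k → W i j ≡ true → W j k ≡ true → W i k ≡ true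
    total      : ∀ i j → (W i j ≡ true) ⊎ (W j i ≡ true)

-- Characteristic vector x^W (only entries with i ≠ j are used).
χ : {n : ℕ} → Rel₂ n → Fin n → Fin n → ℤ
χ W i j with W i j
... | true  = + 1
... | false = + 0

Σ : (n : ℕ) → (Fin n → ℤ) → ℤ
Σ zero    f = + 0
Σ (suc n) f = f zero + Σ n (λ i → f (suc i))

Σ≠ : {n : ℕ} → Fin n → (Fin n → ℤ) → ℤ
Σ≠ {n} i₁ f = Σ n (λ j → g j)
  where
  g : Fin _ → ℤ
  g j with j ≟ i₁
  ... | yes _ = + 0
  ... | no  _ = f j

lhs : {n : ℕ} → Fin n → (Fin n → Fin n → ℤ) → ℤ
lhs i₁ x = Σ≠ i₁ (λ j → x i₁ j + x j i₁) - Σ≠ i₁ (λ j → Σ≠ j (λ j' → h j j'))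
  where
  h : Fin _ → Fin _ → ℤ
  h j j' with j' ≟ i₁
  ... | yes _ = + 0
  ... | no  _ = x j j'

-- Right-hand side 2 − (n−2)(n−3)/2  ((n−2)(n−3) is always even, so the
-- natural-number division is exact).
rhs : ℕ → ℤ
rhs n = + 2 - + (((n ∸ 2) *ℕ (n ∸ 3)) / 2)

-- Validity of lhs ≤ rhs for the weak order polytope, i.e. for every
-- characteristic vector of a weak order on N (vertices of P^n_WO).
ValidForWO : (n : ℕ) → ((Fin n → Fin n → ℤ) → ℤ) → ℤ → Set
ValidForWO n π π₀ = (W : Rel₂ n) → IsWeakOrder W → π (χ W) ≤ π₀

{-# OPTIONS --safe #-}
-- Write x = χ W, m = n − 1, and T for the number of j ≠ i₁ tied with i₁.  By
-- totality x_ab + x_ba = 1 + [a and b are tied], so the first sum equals m + T.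
-- By transitivity two elements tied with i₁ are tied with each other, so twice
-- the second sum, i.e. the sum of x_jj′ + x_j′j over ordered pairs j ≠ j′ of
-- N ∖ {i₁}, is at least m(m − 1) + T(T − 1).  Hence
--   2 · lhs ≤ 2m + 2T − m(m − 1) − T(T − 1) ≤ 4 − (m − 1)(m − 2),
-- because (T − 1)(T − 2) ≥ 0, and 4 − (m − 1)(m − 2) is twice the right-hand side.
module Submission where

open import Defs
open import Data.Nat using (ℕ; _≤_)
open import Data.Fin using (Fin)

open import Data.Bool using (true; false; _∧_)
open import Data.Fin using (zero; suc; punchIn)
open import Data.Fin.Properties using (_≟_; punchInᵢ≢i)
open import Data.Integer using (ℤ; +_; -[1+_]; +≤+; 0ℤ; 1ℤ; _+_; _-_; _*_) renaming (_≤_ to _≤ℤ_)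
import Data.Integer.Properties as ℤ
open import Data.Integer.Tactic.RingSolver using (solve-∀)
open import Data.Nat as ℕ using (suc; s≤s; z≤n; _/_)
open import Data.Nat.DivMod using (m/n*n≤m)
open import Data.Sum using (inj₁; inj₂)
open import Data.Vec.Functional using (removeAt; updateAt)
open import Data.Vec.Functional.Properties using (updateAt-updates; updateAt-minimal)
open import Relation.Binary.PropositionalEquality
open import Relation.Nullary using (yes; no; contradiction)

open import Algebra.Properties.AbelianGroup ℤ.+-0-abelianGroup using (∙-cancelʳ)
open import Algebra.Properties.CommutativeSemigroup ℤ.+-commutativeSemigroup using (interchange)
open import Algebra.Properties.Semiring.Sum ℤ.+-*-semiring using (sum; sum-remove; sum-cong-≗; ∑-distrib-+; ∑-comm; *-distribˡ-sum; *-distribʳ-sum)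

Σ≡sum : ∀ n (f : Fin n → ℤ) → Σ n f ≡ sum f
Σ≡sum ℕ.zero  f = refl
Σ≡sum (suc n) f = cong (_+_ (f zero)) (Σ≡sum n (λ j → f (suc j)))

sum-ones : ∀ n → sum {n} (λ _ → 1ℤ) ≡ + n
sum-ones ℕ.zero  = refl
sum-ones (suc n) = cong (_+_ 1ℤ) (sum-ones n)

sum-mono-≤ : ∀ {n} {f g : Fin n → ℤ} → (∀ j → f j ≤ℤ g j) → sum f ≤ℤ sum g
sum-mono-≤ {ℕ.zero} _   = ℤ.≤-refl
sum-mono-≤ {suc n} f≤g = ℤ.+-mono-≤ (f≤g zero) (sum-mono-≤ (λ j → f≤g (suc j)))

-- The summand of Σ≠ is an anonymous with-function of Defs, so the left-hand
-- side of Σ≠-summand can only be inferred from its use.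
mutual
  Σ≠≡sum-updateAt : ∀ {n} (i : Fin n) (f : Fin n → ℤ) → Σ≠ i f ≡ sum (updateAt f i (λ _ → 0ℤ))
  Σ≠≡sum-updateAt {n} i f = trans (Σ≡sum n _) (sum-cong-≗ (Σ≠-summand i f))

  Σ≠-summand : ∀ {n} (i : Fin n) (f : Fin n → ℤ) (j : Fin n) → _ ≡ updateAt f i (λ _ → 0ℤ) j
  Σ≠-summand i f j with j ≟ i
  ... | yes refl = sym (updateAt-updates j f)
  ... | no j≢i   = sym (updateAt-minimal j i f j≢i)

Σ≠-removeAt : ∀ {n} (i : Fin (suc n)) (f : Fin (suc n) → ℤ) → Σ≠ i f ≡ sum (removeAt f i)
Σ≠-removeAt {n} i f = begin
  Σ≠ i f                     ≡⟨ Σ≠≡sum-updateAt i f ⟩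
  sum f₀                     ≡⟨ sum-remove f₀ ⟩
  f₀ i + sum (removeAt f₀ i) ≡⟨ cong₂ _+_ (updateAt-updates i f) (sum-cong-≗ f₀≗f) ⟩
  0ℤ + sum (removeAt f i)    ≡⟨ ℤ.+-identityˡ _ ⟩
  sum (removeAt f i)         ∎
  where
  open ≡-Reasoning
  f₀ : Fin (suc n) → ℤ
  f₀ = updateAt f i (λ _ → 0ℤ)
  f₀≗f : ∀ j → f₀ (punchIn i j) ≡ f (punchIn i j)
  f₀≗f j = updateAt-minimal (punchIn i j) i f (punchInᵢ≢i i j)

sum≡Σ≠+at : ∀ {n} (i : Fin n) (f : Fin n → ℤ) → sum f ≡ Σ≠ i f + f i
sum≡Σ≠+at {suc n} i f = begin
  sum f                      ≡⟨ sum-remove f ⟩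
  f i + sum (removeAt f i)   ≡⟨ ℤ.+-comm (f i) _ ⟩
  sum (removeAt f i) + f i   ≡⟨ cong (_+ f i) (Σ≠-removeAt i f) ⟨
  Σ≠ i f + f i               ∎
  where open ≡-Reasoning

Σ≠-mono-≤ : ∀ {n} (i : Fin n) {f g : Fin n → ℤ} → (∀ j → j ≢ i → f j ≤ℤ g j) → Σ≠ i f ≤ℤ Σ≠ i g
Σ≠-mono-≤ {suc n} i {f} {g} f≤g = subst₂ _≤ℤ_ (sym (Σ≠-removeAt i f)) (sym (Σ≠-removeAt i g))
  (sum-mono-≤ (λ j → f≤g (punchIn i j) (punchInᵢ≢i i j)))

Σ≠-distrib-+ : ∀ {n} (i : Fin n) (f g : Fin n → ℤ) → Σ≠ i (λ j → f j + g j) ≡ Σ≠ i f + Σ≠ i g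
Σ≠-distrib-+ {suc n} i f g = begin
  Σ≠ i (λ j → f j + g j)                  ≡⟨ Σ≠-removeAt i _ ⟩
  sum (removeAt (λ j → f j + g j) i)      ≡⟨ ∑-distrib-+ (removeAt f i) (removeAt g i) ⟩
  sum (removeAt f i) + sum (removeAt g i) ≡⟨ cong₂ _+_ (Σ≠-removeAt i f) (Σ≠-removeAt i g) ⟨
  Σ≠ i f + Σ≠ i g                         ∎
  where open ≡-Reasoning

Σ≠-punchIn : ∀ {m} (i : Fin (suc m)) (a : Fin m) {h : Fin (suc m) → ℤ} {f : Fin m → ℤ} →
             h i ≡ 0ℤ → (∀ b → h (punchIn i b) ≡ f b) → Σ≠ (punchIn i a) h ≡ Σ≠ a f
Σ≠-punchIn i a {h} {f} hᵢ≡0 h∘pᵢ≗f = ∙-cancelʳ (f a) _ _ (begin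
  Σ≠ (punchIn i a) h + f a             ≡⟨ cong (_+_ (Σ≠ (punchIn i a) h)) (h∘pᵢ≗f a) ⟨
  Σ≠ (punchIn i a) h + h (punchIn i a) ≡⟨ sum≡Σ≠+at (punchIn i a) h ⟨
  sum h                                ≡⟨ sum-remove h ⟩
  h i + sum (removeAt h i)             ≡⟨ cong₂ _+_ hᵢ≡0 (sum-cong-≗ h∘pᵢ≗f) ⟩
  0ℤ + sum f                           ≡⟨ ℤ.+-identityˡ (sum f) ⟩
  sum f                                ≡⟨ sum≡Σ≠+at a f ⟩
  Σ≠ a f + f a                         ∎)
  where open ≡-Reasoning

ΣΣ≠ : ∀ {n} → (Fin n → Fin n → ℤ) → ℤ
ΣΣ≠ g = sum (λ a → Σ≠ a (g a))

ΣΣ≠+diagonal : ∀ {n} (g : Fin n → Fin n → ℤ) → ΣΣ≠ g + sum (λ a → g a a) ≡ sum (λ a → sum (g a))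
ΣΣ≠+diagonal g = trans (sym (∑-distrib-+ (λ a → Σ≠ a (g a)) (λ a → g a a)))
                       (sum-cong-≗ (λ a → sym (sum≡Σ≠+at a (g a))))

ΣΣ≠-transpose : ∀ {n} (g : Fin n → Fin n → ℤ) → ΣΣ≠ g ≡ ΣΣ≠ (λ a b → g b a)
ΣΣ≠-transpose g = ∙-cancelʳ (sum (λ a → g a a)) _ _ (begin
  ΣΣ≠ g + sum (λ a → g a a)               ≡⟨ ΣΣ≠+diagonal g ⟩
  sum (λ a → sum (g a))                   ≡⟨ ∑-comm g ⟩
  sum (λ b → sum (λ a → g a b))           ≡⟨ ΣΣ≠+diagonal (λ a b → g b a) ⟨
  ΣΣ≠ (λ a b → g b a) + sum (λ a → g a a) ∎)
  where open ≡-Reasoning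

ΣΣ≠-distrib-+ : ∀ {n} (g h : Fin n → Fin n → ℤ) → ΣΣ≠ (λ a b → g a b + h a b) ≡ ΣΣ≠ g + ΣΣ≠ h
ΣΣ≠-distrib-+ g h = trans (sum-cong-≗ (λ a → Σ≠-distrib-+ a (g a) (h a)))
                          (∑-distrib-+ (λ a → Σ≠ a (g a)) (λ a → Σ≠ a (h a)))

ΣΣ≠-mono-≤ : ∀ {n} {g h : Fin n → Fin n → ℤ} → (∀ a b → b ≢ a → g a b ≤ℤ h a b) → ΣΣ≠ g ≤ℤ ΣΣ≠ h
ΣΣ≠-mono-≤ g≤h = sum-mono-≤ (λ a → Σ≠-mono-≤ a (g≤h a))

ΣΣ≠-product : ∀ {n} (t : Fin n → ℤ) → (∀ a → t a * t a ≡ t a) →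
              ΣΣ≠ (λ a b → t a * t b) + sum t ≡ sum t * sum t
ΣΣ≠-product {n} t t²≡t = begin
  ΣΣ≠ tt + sum t                    ≡⟨ cong (_+_ (ΣΣ≠ tt)) (sum-cong-≗ t²≡t) ⟨
  ΣΣ≠ tt + sum (λ a → t a * t a)    ≡⟨ ΣΣ≠+diagonal tt ⟩
  sum (λ a → sum (λ b → t a * t b)) ≡⟨ sum-cong-≗ (λ a → *-distribˡ-sum (t a) t) ⟨
  sum (λ a → t a * sum t)           ≡⟨ *-distribʳ-sum (sum t) t ⟨
  sum t * sum t                     ∎
  where
  open ≡-Reasoning
  tt : Fin n → Fin n → ℤ
  tt a b = t a * t b

ΣΣ≠-lower-bound : ∀ {n} (t : Fin n → ℤ) (s : Fin n → Fin n → ℤ) → (∀ a → t a * t a ≡ t a) →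
                  (∀ a b → b ≢ a → 1ℤ + t a * t b ≤ℤ s a b) →
                  + n * + n + sum t * sum t ≤ℤ ΣΣ≠ s + (+ n + sum t)
ΣΣ≠-lower-bound {n} t s t²≡t 1+tt≤s = begin
  + n * + n + sum t * sum t                    ≡⟨ cong₂ _+_ ones (ΣΣ≠-product t t²≡t) ⟨
  (ΣΣ≠ 𝟙 + + n) + (ΣΣ≠ tt + sum t)             ≡⟨ interchange (ΣΣ≠ 𝟙) (+ n) (ΣΣ≠ tt) (sum t) ⟩
  (ΣΣ≠ 𝟙 + ΣΣ≠ tt) + (+ n + sum t)             ≡⟨ cong (_+ (+ n + sum t)) (ΣΣ≠-distrib-+ 𝟙 tt) ⟨
  ΣΣ≠ (λ a b → 1ℤ + t a * t b) + (+ n + sum t) ≤⟨ ℤ.+-monoˡ-≤ (+ n + sum t) (ΣΣ≠-mono-≤ 1+tt≤s) ⟩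
  ΣΣ≠ s + (+ n + sum t)                        ∎
  where
  open ℤ.≤-Reasoning
  𝟙 tt : Fin n → Fin n → ℤ
  𝟙 _ _ = 1ℤ
  tt a b = t a * t b
  ones : ΣΣ≠ 𝟙 + + n ≡ + n * + n
  ones = subst (λ k → ΣΣ≠ 𝟙 + k ≡ k * k) (sum-ones n)
               (ΣΣ≠-product {n} (λ _ → 1ℤ) (λ _ → refl))

tied : ∀ {n} → Rel₂ n → Rel₂ n
tied W a b = W a b ∧ W b a

χ-nonneg : ∀ {n} (R : Rel₂ n) a b → 0ℤ ≤ℤ χ R a b
χ-nonneg R a b with R a b
... | true  = +≤+ z≤n
... | false = +≤+ z≤n

χ-idem : ∀ {n} (R : Rel₂ n) a b → χ R a b * χ R a b ≡ χ R a b
χ-idem R a b with R a b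
... | true  = refl
... | false = refl

module _ {n} {W : Rel₂ n} (wo : IsWeakOrder W) where
  open IsWeakOrder wo

  χ+χᵀ≡1+χ-tied : ∀ a b → χ W a b + χ W b a ≡ 1ℤ + χ (tied W) a b
  χ+χᵀ≡1+χ-tied a b with W a b | W b a | total a b
  ... | true  | true  | _      = refl
  ... | true  | false | _      = refl
  ... | false | true  | _      = refl
  ... | false | false | inj₁ ()
  ... | false | false | inj₂ ()

  χ-tied-transitive : ∀ c a b → χ (tied W) c a * χ (tied W) c b ≤ℤ χ (tied W) a b
  χ-tied-transitive c a b with W c a in ca | W a c in ac | W c b in cb | W b c in bc
  ... | false | _     | _     | _     = χ-nonneg (tied W) a b
  ... | true  | false | _     | _     = χ-nonneg (tied W) a b
  ... | true  | true  | false | _     = χ-nonneg (tied W) a b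
  ... | true  | true  | true  | false = χ-nonneg (tied W) a b
  ... | true  | true  | true  | true
    rewrite transitive a c b ac cb | transitive b c a bc ca = ℤ.≤-refl

module _ {m} (i : Fin (suc m)) where

  -- As for Σ≠, the inner summand of lhs is an anonymous with-function of Defs.
  mutual
    lhs-restricted : (x : Fin (suc m) → Fin (suc m) → ℤ) →
                     lhs i x ≡ sum (λ a → x i (punchIn i a) + x (punchIn i a) i)
                               - ΣΣ≠ (λ a b → x (punchIn i a) (punchIn i b))
    lhs-restricted x = cong₂ _-_ (Σ≠-removeAt i _) (trans (Σ≠-removeAt i _)
      (sum-cong-≗ (λ a → Σ≠-punchIn i a (inner-at-i x a) (inner-off-i x a))))

    inner-at-i : ∀ (x : Fin (suc m) → Fin (suc m) → ℤ) (a : Fin m) → _ ≡ 0ℤ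
    inner-at-i x a with i ≟ i
    ... | yes _   = refl
    ... | no i≢i = contradiction refl i≢i

    inner-off-i : ∀ (x : Fin (suc m) → Fin (suc m) → ℤ) (a b : Fin m) →
                  _ ≡ x (punchIn i a) (punchIn i b)
    inner-off-i x a b with punchIn i b ≟ i
    ... | yes pᵢb≡i = contradiction pᵢb≡i (punchInᵢ≢i i b)
    ... | no _       = refl

0≤[i-1]*[i-2] : ∀ i → 0ℤ ≤ℤ (i - 1ℤ) * (i - + 2)
0≤[i-1]*[i-2] (+ 0)           = +≤+ z≤n
0≤[i-1]*[i-2] (+ 1)           = +≤+ z≤n
0≤[i-1]*[i-2] (+ suc (suc k)) = subst (0ℤ ≤ℤ_) (ℤ.pos-* (suc k) k) (+≤+ z≤n)
0≤[i-1]*[i-2] -[1+ k ]        = +≤+ z≤n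

counting-bound : ∀ M T D → M * M + T * T ≤ℤ D + D + (M + T) →
                 + 2 * ((M + T) - D) + (M - 1ℤ) * (M - + 2) ≤ℤ + 4
counting-bound M T D h = ℤ.0≤i-j⇒j≤i (subst (0ℤ ≤ℤ_) (sym (slack M T D))
  (ℤ.+-mono-≤ (ℤ.i≤j⇒0≤j-i h) (0≤[i-1]*[i-2] T)))
  where
  slack : ∀ M T D → + 4 - (+ 2 * ((M + T) - D) + (M - 1ℤ) * (M - + 2))
                    ≡ ((D + D + (M + T)) - (M * M + T * T)) + (T - 1ℤ) * (T - + 2)
  slack = solve-∀

module _ {m} {W : Rel₂ (suc m)} (wo : IsWeakOrder W) (i : Fin (suc m)) where

  tied-i : Fin m → ℤ
  tied-i a = χ (tied W) i (punchIn i a)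

  χ∖i : Fin m → Fin m → ℤ
  χ∖i a b = χ W (punchIn i a) (punchIn i b)

  incident-sum : sum (λ a → χ W i (punchIn i a) + χ W (punchIn i a) i) ≡ + m + sum tied-i
  incident-sum = begin
    sum (λ a → χ W i (punchIn i a) + χ W (punchIn i a) i)
      ≡⟨ sum-cong-≗ (λ a → χ+χᵀ≡1+χ-tied wo i (punchIn i a)) ⟩
    sum (λ a → 1ℤ + tied-i a)
      ≡⟨ ∑-distrib-+ (λ _ → 1ℤ) tied-i ⟩
    sum {m} (λ _ → 1ℤ) + sum tied-i
      ≡⟨ cong (_+ sum tied-i) (sum-ones m) ⟩
    + m + sum tied-i
      ∎
    where open ≡-Reasoning

  pair-sum-bound : + m * + m + sum tied-i * sum tied-i ≤ℤ ΣΣ≠ χ∖i + ΣΣ≠ χ∖i + (+ m + sum tied-i)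
  pair-sum-bound = begin
    + m * + m + sum tied-i * sum tied-i
      ≤⟨ ΣΣ≠-lower-bound tied-i _ (λ a → χ-idem (tied W) i (punchIn i a)) 1+tt≤χ+χᵀ ⟩
    ΣΣ≠ (λ a b → χ∖i a b + χ∖i b a) + (+ m + sum tied-i)
      ≡⟨ cong (_+ (+ m + sum tied-i)) (ΣΣ≠-distrib-+ χ∖i (λ a b → χ∖i b a)) ⟩
    ΣΣ≠ χ∖i + ΣΣ≠ (λ a b → χ∖i b a) + (+ m + sum tied-i)
      ≡⟨ cong (λ s → ΣΣ≠ χ∖i + s + (+ m + sum tied-i)) (ΣΣ≠-transpose χ∖i) ⟨
    ΣΣ≠ χ∖i + ΣΣ≠ χ∖i + (+ m + sum tied-i)
      ∎
    where
    open ℤ.≤-Reasoning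
    1+tt≤χ+χᵀ : ∀ a b → b ≢ a → 1ℤ + tied-i a * tied-i b ≤ℤ χ∖i a b + χ∖i b a
    1+tt≤χ+χᵀ a b _ = subst (1ℤ + tied-i a * tied-i b ≤ℤ_)
      (sym (χ+χᵀ≡1+χ-tied wo (punchIn i a) (punchIn i b)))
      (ℤ.+-monoʳ-≤ 1ℤ (χ-tied-transitive wo i (punchIn i a) (punchIn i b)))

  lhs-bound : + 2 * lhs i (χ W) + (+ m - 1ℤ) * (+ m - + 2) ≤ℤ + 4
  lhs-bound = subst (λ L → + 2 * L + (+ m - 1ℤ) * (+ m - + 2) ≤ℤ + 4)
    (sym (trans (lhs-restricted i (χ W)) (cong (_- ΣΣ≠ χ∖i) incident-sum)))
    (counting-bound (+ m) (sum tied-i) (ΣΣ≠ χ∖i) pair-sum-bound)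

halve-bound : ∀ (L : ℤ) (c : ℕ) → + 2 * L + + c ≤ℤ + 4 → L ≤ℤ + 2 - + (c / 2)
halve-bound L c h = ℤ.*-cancelˡ-≤-pos L (+ 2 - + (c / 2)) (+ 2) (ℤ.0≤i-j⇒j≤i
  (subst (0ℤ ≤ℤ_) (sym (slack L (+ c) (+ (c / 2))))
    (ℤ.+-mono-≤ (ℤ.i≤j⇒0≤j-i h)
      (ℤ.i≤j⇒0≤j-i (subst (_≤ℤ + c) (ℤ.pos-* (c / 2) 2) (+≤+ (m/n*n≤m c 2)))))))
  where
  slack : ∀ L c q → + 2 * (+ 2 - q) - + 2 * L ≡ (+ 4 - (+ 2 * L + c)) + (c - q * + 2)
  slack = solve-∀

theorem2 : (n : ℕ) → 4 ≤ n → (i₁ : Fin n) → ValidForWO n (lhs i₁) (rhs n)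
theorem2 (suc (suc (suc k))) (s≤s (s≤s (s≤s _))) i₁ W wo =
  halve-bound (lhs i₁ (χ W)) (suc k ℕ.* k)
    (subst (λ c → + 2 * lhs i₁ (χ W) + c ≤ℤ + 4) (sym (ℤ.pos-* (suc k) k)) (lhs-bound wo i₁))
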